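{- Let $B\in M_n(\mathbb{Z})$ be a skew-symmetrizable matrix. Then for any $n\times n$ permutation matrix $P$, \[ \delta(PBP^{\top})\equiv\delta(B)\pmod 4 . \]
   Context: A matrix $B=(b_{ij})\in M_n(\mathbb{Z})$ is skew-symmetrizable if there is a diagonal matrix $D=\operatorname{diag}(d_1,\dots,d_n)$ with positive integers $d_i$ such that $DB$ is skew-symmetric. The symmetrization of $B$ is the real symmetric matrix $\mathfrak{S}(B)=(s_{ij})$ with $s_{ii}=2$, $s_{ij}=\operatorname{sgn}(b_{ij})\sqrt{|b_{ij}b_{ji}|}$ for $i<j$, and $s_{ij}=\operatorname{sgn}(b_{ji})\sqrt{|b_{ij}b_{ji}|}$ for $i>j$, where $\operatorname{sgn}(0)=0$. One has $\det\mathfrak{S}(B)\in\mathbb{Z}$, and $\delta(B)$ denotes the residue of $\det(\mathfrak{S}(B))$ modulo $4$. -}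

module Defs where

open import Data.Nat as ℕ using (ℕ; zero; suc; _≤ᵇ_; NonZero)
open import Data.Integer as ℤ using (ℤ; +_; -[1+_]; +[1+_]; -_; ∣_∣; _◃_)
open import Data.Integer.DivMod using (_%ℕ_)
open import Data.Fin as Fin using (Fin; toℕ; punchIn; _≟_)
open import Data.Fin.Permutation using (Permutation′; _⟨$⟩ʳ_)
open import Data.List as List using (List; []; _∷_; _++_)
open import Data.Product using (Σ; ∃; _×_; _,_)
open import Data.Bool using (if_then_else_)
open import Relation.Nullary using (does)
open import Data.Fin.Properties using (<-cmp)
open import Relation.Binary using (Tri; tri<; tri≈; tri>)
open import Relation.Binary.PropositionalEquality using (_≡_)

Matrix : ℕ → Set
Matrix n = Fin n → Fin n → ℤ

∑ : ∀ {n} → (Fin n → ℤ) → ℤ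
∑ {zero}  f = + 0
∑ {suc n} f = f Fin.zero ℤ.+ ∑ (λ i → f (Fin.suc i))

_·_ : ∀ {n} → Matrix n → Matrix n → Matrix n
(A · B) i j = ∑ (λ k → A i k ℤ.* B k j)

transpose : ∀ {n} → Matrix n → Matrix n
transpose A i j = A j i

permMatrix : ∀ {n} → Permutation′ n → Matrix n
permMatrix π i j = if does (j ≟ (π ⟨$⟩ʳ i)) then + 1 else + 0

-- skew-symmetrizable: D B skew-symmetric for some positive diagonal D
SkewSymmetrizable : ∀ {n} → Matrix n → Set
SkewSymmetrizable {n} B =
  Σ (Fin n → ℕ) λ d → ((i : Fin n) → NonZero (d i)) ×
    ((i j : Fin n) → (+ d i) ℤ.* B i j ≡ - ((+ d j) ℤ.* B j i))

sgn : ℤ → ℤ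
sgn (+ zero)   = + 0
sgn +[1+ _ ]   = + 1
sgn -[1+ _ ]   = - (+ 1)

-- A "signed square root" c·√r (c : ℤ, r : ℕ).  Every entry of 𝔖(B) has
-- this form: s_ii = 1·√4, s_ij = sgn(..)·√|b_ij b_ji|.
Root : Set
Root = ℤ × ℕ

rmul : Root → Root → Root
rmul (c , r) (c' , r') = (c ℤ.* c' , r ℕ.* r')

𝔖 : ∀ {n} → Matrix n → Fin n → Fin n → Root
𝔖 B i j with <-cmp i j
... | tri< _ _ _ = (sgn (B i j) , ∣ B i j ℤ.* B j i ∣)
... | tri≈ _ _ _ = (+ 1 , 4)
... | tri> _ _ _ = (sgn (B j i) , ∣ B i j ℤ.* B j i ∣)

alt : ℕ → ℤ
alt zero    = + 1
alt (suc k) = - alt k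

-- Leibniz/Laplace expansion of the determinant of a matrix of signed square
-- roots, kept as a formal list of monomials c·√r (using √a·√b = √(ab)).
-- Expansion along the first row.
detR : ∀ {n} → (Fin n → Fin n → Root) → List Root
detR {zero}  M = (+ 1 , 1) ∷ []
detR {suc n} M = List.concatMap term (List.allFin (suc n))
  where
  term : Fin (suc n) → List Root
  term j = List.map (rmul (rmul (alt (toℕ j) , 1) (M Fin.zero j)))
                    (detR (λ a b → M (Fin.suc a) (punchIn j b)))

isqrt : ℕ → ℕ
isqrt m = go m
  where
  go : ℕ → ℕ
  go zero    = zero
  go (suc k) = if (suc k ℕ.* suc k) ≤ᵇ m then suc k else go k

-- value of a formal sum of signed square roots whose radicands are perfect
-- squares (always the case for the monomials of det 𝔖(B), B skew-symmetrizable)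
evalR : List Root → ℤ
evalR []             = + 0
evalR ((c , r) ∷ xs) = c ℤ.* (+ isqrt r) ℤ.+ evalR xs

det𝔖 : ∀ {n} → Matrix n → ℤ
det𝔖 B = evalR (detR (𝔖 B))

δ : ∀ {n} → Matrix n → ℕ
δ B = det𝔖 B %ℕ 4

{-# OPTIONS --safe #-}
module Submission where

-- Conjugating B by a permutation matrix reindexes it by the permutation, and every permutation
-- is a product of adjacent transpositions, so it suffices to swap two adjacent indices k, k + 1.
-- Since the signs of B are skew, this reindexes 𝔖(B) by the same swap, which does not change
-- the determinant, except that the pair of entries at (k, k + 1) and (k + 1, k) changes sign.
-- Write that pair as E + Eᵀ with E supported on row k, and the rest as a symmetric S. Then
-- d(x, y) = det (S + x E + y Eᵀ) is affine in x and symmetric in (x, y), so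
-- d(1, 1) - d(-1, -1) is four times the coefficient of x in d(x, 0).
--
-- The entries of 𝔖(B) are signed square roots and det 𝔖(B) is evaluated monomial by monomial
-- with isqrt, which is additive but not multiplicative. Determinants are therefore computed in
-- the ring of formal ℤ-combinations of square roots (the monoid ring of (ℕ, ·)), in which two
-- sums are equal when they agree under every weight ℕ → ℤ; only the final, additive step
-- evaluates with isqrt.

open import Level using (0ℓ)
open import Algebra.Bundles using (CommutativeRing)
open import Function using (_∘_)
open import Data.Nat as ℕ using (ℕ; zero; suc; NonZero)
import Data.Nat.Properties as ℕ
open import Data.Integer as ℤ using (ℤ; +_; 0ℤ; ∣_∣; +[1+_]; -[1+_])
import Data.Integer.Properties as ℤ
open import Data.Integer.DivMod using (_%ℕ_; _/ℕ_; a≡a%ℕn+[a/ℕn]*n; n%ℕd<d)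
open import Data.Integer.Tactic.RingSolver using (solve-∀)
open import Data.Fin using (Fin; zero; suc; toℕ; punchIn; inject₁; _≟_)
open import Data.Fin.Properties using (suc-injective; <-cmp)
open import Data.Fin.Permutation using (Permutation′; _⟨$⟩ʳ_; remove; punchIn-permute)
open import Data.List as List using (List; []; _∷_; _++_; [_])
import Data.List.Properties as List
open import Data.Product using (∃-syntax; _,_; proj₁; proj₂; map₁)
open import Data.Bool using (if_then_else_)
open import Data.Empty using (⊥-elim)
open import Relation.Nullary using (does; contradiction)
open import Relation.Binary using (tri<; tri≈; tri>)
open import Relation.Binary.PropositionalEquality as ≡ using (_≡_; _≢_)
import Defs

private
  variable
    m n : ℕ

adjacentSwap : Fin m → Fin (suc m) → Fin (suc m)
adjacentSwap zero    zero          = suc zero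
adjacentSwap zero    (suc zero)    = zero
adjacentSwap zero    (suc (suc i)) = suc (suc i)
adjacentSwap (suc k) zero          = zero
adjacentSwap (suc k) (suc i)       = suc (adjacentSwap k i)

adjacentSwap₀-suc : (b : Fin (suc n)) → adjacentSwap zero (suc b) ≡ punchIn (suc zero) b
adjacentSwap₀-suc zero    = ≡.refl
adjacentSwap₀-suc (suc b) = ≡.refl

adjacentSwap₀-punchIn₁ : (b : Fin (suc n)) → adjacentSwap zero (punchIn (suc zero) b) ≡ suc b
adjacentSwap₀-punchIn₁ zero    = ≡.refl
adjacentSwap₀-punchIn₁ (suc b) = ≡.refl

adjacentSwap₀-punchIn : (j : Fin (suc n)) (b : Fin (suc (suc n))) →
  adjacentSwap zero (punchIn (suc (suc j)) b) ≡ punchIn (suc (suc j)) (adjacentSwap zero b)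
adjacentSwap₀-punchIn j zero          = ≡.refl
adjacentSwap₀-punchIn j (suc zero)    = ≡.refl
adjacentSwap₀-punchIn j (suc (suc b)) = ≡.refl

-- Determinants over a commutative ring

module Determinant {c ℓ} (R : CommutativeRing c ℓ) where

  open CommutativeRing R hiding (zero)
  open import Algebra.Properties.Ring ring
    using (-‿distribˡ-*; -‿distribʳ-*; -‿involutive; -‿+-comm; -‿anti-homo-+; -0#≈0#; -1*x≈-x;
           +-cancelʳ; //-rightDividesˡ)
  open import Algebra.Properties.CommutativeSemigroup +-commutativeSemigroup
    using (interchange; xy∙z≈xz∙y; xy∙z≈yz∙x; x∙yz≈xz∙y)
    renaming (x∙yz≈y∙xz to x+[y+z]≈y+[x+z])
  open import Algebra.Properties.CommutativeSemigroup *-commutativeSemigroup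
    using () renaming (x∙yz≈y∙xz to x*[y*z]≈y*[x*z])
  import Algebra.Properties.Semiring.Sum semiring as Sum
  open import Algebra.Properties.CommutativeMonoid.Mult +-commutativeMonoid public
    using (_×_)
  open import Algebra.Properties.CommutativeMonoid.Mult +-commutativeMonoid
    using (×-congʳ; ×-distrib-+; ×-assocˡ)
  open import Relation.Binary.Reasoning.Setoid setoid

  -- Opaque, so that unification compares ∑ f with ∑ g instead of their unfoldings;
  -- this keeps the implicit arguments of congruence lemmas under ∑ inferable.
  opaque
    ∑ : (Fin n → Carrier) → Carrier
    ∑ = Sum.sum

    ∑-zero : (f : Fin zero → Carrier) → ∑ f ≡ 0#
    ∑-zero f = ≡.refl

    ∑-suc : (f : Fin (suc n) → Carrier) → ∑ f ≡ f zero + ∑ (λ i → f (suc i))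
    ∑-suc f = ≡.refl

    ∑-cong : {f g : Fin n → Carrier} → (∀ i → f i ≈ g i) → ∑ f ≈ ∑ g
    ∑-cong = Sum.sum-cong-≋

    ∑-distrib-+ : (f g : Fin n → Carrier) → ∑ (λ i → f i + g i) ≈ ∑ f + ∑ g
    ∑-distrib-+ = Sum.∑-distrib-+

    ∑-comm : (f : Fin m → Fin n → Carrier) → ∑ (λ i → ∑ (f i)) ≈ ∑ (λ j → ∑ (λ i → f i j))
    ∑-comm = Sum.∑-comm

    *-distribˡ-∑ : ∀ x (f : Fin n → Carrier) → x * ∑ f ≈ ∑ (λ i → x * f i)
    *-distribˡ-∑ = Sum.*-distribˡ-sum

  -‿∑ : (f : Fin n → Carrier) → - ∑ f ≈ ∑ λ i → - f i
  -‿∑ f = begin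
    - ∑ f                ≈⟨ -1*x≈-x (∑ f) ⟨
    - 1# * ∑ f           ≈⟨ *-distribˡ-∑ (- 1#) f ⟩
    ∑ (λ i → - 1# * f i) ≈⟨ ∑-cong (λ i → -1*x≈-x (f i)) ⟩
    ∑ (λ i → - f i)      ∎

  ∑-affine : (f g : Fin n → Carrier) (x : Carrier) → (∑ λ j → f j + x * g j) ≈ ∑ f + x * ∑ g
  ∑-affine f g x = trans (∑-distrib-+ f _) (+-congˡ (sym (*-distribˡ-∑ x g)))

  Matrix : ℕ → Set c
  Matrix n = Fin n → Fin n → Carrier

  transpose : Matrix n → Matrix n
  transpose A i j = A j i

  swapRows : Fin m → Matrix (suc m) → Matrix (suc m)
  swapRows k A i j = A (adjacentSwap k i) j

  swapColumns : Fin m → Matrix (suc m) → Matrix (suc m)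
  swapColumns k A i j = A i (adjacentSwap k j)

  sign : ℕ → Carrier
  sign zero    = 1#
  sign (suc k) = - sign k

  minor : Fin (suc n) → Matrix (suc n) → Matrix n
  minor j A a b = A (suc a) (punchIn j b)

  det : Matrix n → Carrier
  det {zero}  A = 1#
  det {suc n} A = ∑ λ j → (sign (toℕ j) * A zero j) * det (minor j A)

  laplaceTerm : Matrix (suc n) → Fin (suc n) → Carrier
  laplaceTerm A j = (sign (toℕ j) * A zero j) * det (minor j A)

  sign-suc-* : ∀ k a b → (sign (suc k) * a) * b ≈ - ((sign k * a) * b)
  sign-suc-* k a b = trans (*-congʳ (sym (-‿distribˡ-* (sign k) a))) (sym (-‿distribˡ-* (sign k * a) b))

  det-cong : {A B : Matrix n} → (∀ i j → A i j ≈ B i j) → det A ≈ det B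
  det-cong {zero}  A≈B = refl
  det-cong {suc n} A≈B =
    ∑-cong λ j → *-cong (*-congˡ (A≈B zero j)) (det-cong λ a b → A≈B (suc a) (punchIn j b))

  det-cong-≡ : {A B : Matrix n} → (∀ i j → A i j ≡ B i j) → det A ≈ det B
  det-cong-≡ A≡B = det-cong λ i j → reflexive (A≡B i j)

  det-expandFirstColumn : (A : Matrix (suc n)) →
    det A ≈ ∑ λ i → (sign (toℕ i) * A i zero) * det (λ a b → A (punchIn i a) (suc b))
  det-expandFirstColumn {zero}  A = ∑-cong λ { zero → refl }
  det-expandFirstColumn {suc n} A = begin
      det A
    ≡⟨ ∑-suc _ ⟩
      t₀ + ∑ (λ j → (sign (suc (toℕ j)) * A zero (suc j)) * det (minor (suc j) A))
    ≈⟨ +-congˡ (∑-cong λ j → *-congˡ (det-expandFirstColumn (minor (suc j) A))) ⟩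
      t₀ + ∑ (λ j → (sign (suc (toℕ j)) * A zero (suc j)) * ∑ λ i → q i * X i j)
    ≈⟨ +-congˡ (∑-cong λ j → pull (toℕ j) (A zero (suc j)) (λ i → q i * X i j)) ⟩
      t₀ + ∑ (λ j → ∑ λ i → - (p j * (q i * X i j)))
    ≈⟨ +-congˡ (∑-comm _) ⟩
      t₀ + ∑ (λ i → ∑ λ j → - (p j * (q i * X i j)))
    ≈⟨ +-congˡ (∑-cong λ i → ∑-cong λ j → -‿cong (x*[y*z]≈y*[x*z] (p j) (q i) (X i j))) ⟩
      t₀ + ∑ (λ i → ∑ λ j → - (q i * (p j * X i j)))
    ≈⟨ +-congˡ (∑-cong λ i → pull (toℕ i) (A (suc i) zero) (λ j → p j * X i j)) ⟨
      t₀ + ∑ (λ i → (sign (suc (toℕ i)) * A (suc i) zero) * ∑ λ j → p j * X i j)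
    ≡⟨ ∑-suc _ ⟨
      ∑ (λ i → (sign (toℕ i) * A i zero) * det (λ a b → A (punchIn i a) (suc b))) ∎
    where
    t₀ = laplaceTerm A zero
    p q : Fin (suc n) → Carrier
    p j = sign (toℕ j) * A zero (suc j)
    q i = sign (toℕ i) * A (suc i) zero
    X : Fin (suc n) → Fin (suc n) → Carrier
    X i j = det (λ a b → A (suc (punchIn i a)) (suc (punchIn j b)))
    pull : ∀ s a (g : Fin (suc n) → Carrier) →
      (sign (suc s) * a) * ∑ g ≈ ∑ λ i → - ((sign s * a) * g i)
    pull s a g = trans (sign-suc-* s a (∑ g)) (trans (-‿cong (*-distribˡ-∑ (sign s * a) g)) (-‿∑ _))

  det-transpose : (A : Matrix n) → det (transpose A) ≈ det A
  det-transpose {zero}  A = refl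
  det-transpose {suc n} A = trans
    (∑-cong λ j → *-congˡ (det-transpose λ a b → A (punchIn j a) (suc b)))
    (sym (det-expandFirstColumn A))

  private
    det-leadingTerms : (A : Matrix (suc (suc n))) →
      det A ≡ laplaceTerm A zero + (laplaceTerm A (suc zero) + ∑ λ j → laplaceTerm A (suc (suc j)))
    det-leadingTerms A = ≡.trans (∑-suc _) (≡.cong (_+_ (laplaceTerm A zero)) (∑-suc _))

    swapFirstColumns-viaTail : (A : Matrix (suc (suc n))) →
      (∑ λ j → laplaceTerm (swapColumns zero A) (suc (suc j))) ≈ - ∑ (λ j → laplaceTerm A (suc (suc j))) →
      det (swapColumns zero A) ≈ - det A
    swapFirstColumns-viaTail A tail = begin
        det A′
      ≡⟨ det-leadingTerms A′ ⟩
        laplaceTerm A′ zero + (laplaceTerm A′ (suc zero) + ∑ λ j → laplaceTerm A′ (suc (suc j)))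
      ≈⟨ +-cong first (+-cong second tail) ⟩
        - T₁ + (- T₀ + - ∑ λ j → laplaceTerm A (suc (suc j)))
      ≈⟨ x+[y+z]≈y+[x+z] _ _ _ ⟩
        - T₀ + (- T₁ + - ∑ λ j → laplaceTerm A (suc (suc j)))
      ≈⟨ +-congˡ (-‿+-comm _ _) ⟩
        - T₀ + - (T₁ + ∑ λ j → laplaceTerm A (suc (suc j)))
      ≈⟨ -‿+-comm _ _ ⟩
        - (T₀ + (T₁ + ∑ λ j → laplaceTerm A (suc (suc j))))
      ≡⟨ ≡.cong -_ (det-leadingTerms A) ⟨
        - det A ∎
      where
      A′ = swapColumns zero A
      T₀ = laplaceTerm A zero
      T₁ = laplaceTerm A (suc zero)
      M₁ = det (minor (suc zero) A)
      first : laplaceTerm A′ zero ≈ - T₁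
      first = begin
        (1# * A zero (suc zero)) * det (minor zero A′)
          ≈⟨ *-congˡ (det-cong-≡ λ a b → ≡.cong (A (suc a)) (adjacentSwap₀-suc b)) ⟩
        (1# * A zero (suc zero)) * M₁        ≈⟨ -‿involutive _ ⟨
        - - ((1# * A zero (suc zero)) * M₁)  ≈⟨ -‿cong (sign-suc-* 0 _ _) ⟨
        - T₁                                 ∎
      second : laplaceTerm A′ (suc zero) ≈ - T₀
      second = trans (*-congˡ (det-cong-≡ λ a b → ≡.cong (A (suc a)) (adjacentSwap₀-punchIn₁ b)))
                     (sign-suc-* 0 _ _)

  det-swapFirstColumns : (A : Matrix (suc (suc n))) → det (swapColumns zero A) ≈ - det A
  det-swapFirstColumns {zero}  A = swapFirstColumns-viaTail A (begin
    ∑ _   ≡⟨ ∑-zero _ ⟩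
    0#    ≈⟨ -0#≈0# ⟨
    - 0#  ≡⟨ ≡.cong -_ (∑-zero _) ⟨
    - ∑ _ ∎)
  det-swapFirstColumns {suc n} A = swapFirstColumns-viaTail A (begin
      ∑ (λ j → s j * det (minor (suc (suc j)) (swapColumns zero A)))
    ≈⟨ ∑-cong (λ j → *-congˡ (det-cong-≡ λ a b → ≡.cong (A (suc a)) (adjacentSwap₀-punchIn j b))) ⟩
      ∑ (λ j → s j * det (swapColumns zero (minor (suc (suc j)) A)))
    ≈⟨ ∑-cong (λ j → *-congˡ (det-swapFirstColumns (minor (suc (suc j)) A))) ⟩
      ∑ (λ j → s j * - det (minor (suc (suc j)) A))
    ≈⟨ ∑-cong (λ j → -‿distribʳ-* (s j) _) ⟨
      ∑ (λ j → - (s j * det (minor (suc (suc j)) A)))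
    ≈⟨ -‿∑ _ ⟨
      - ∑ (λ j → s j * det (minor (suc (suc j)) A)) ∎)
    where
    s : Fin (suc n) → Carrier
    s j = sign (toℕ (suc (suc j))) * A zero (suc (suc j))

  det-swapRows : (k : Fin m) (A : Matrix (suc m)) → det (swapRows k A) ≈ - det A
  det-swapRows zero A = begin
    det (swapRows zero A)                ≈⟨ det-transpose (swapRows zero A) ⟨
    det (swapColumns zero (transpose A)) ≈⟨ det-swapFirstColumns (transpose A) ⟩
    - det (transpose A)                  ≈⟨ -‿cong (det-transpose A) ⟩
    - det A                              ∎
  det-swapRows (suc k) A = begin
      ∑ (λ j → (sign (toℕ j) * A zero j) * det (swapRows k (minor j A)))
    ≈⟨ ∑-cong (λ j → *-congˡ (det-swapRows k (minor j A))) ⟩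
      ∑ (λ j → (sign (toℕ j) * A zero j) * - det (minor j A))
    ≈⟨ ∑-cong (λ j → -‿distribʳ-* _ _) ⟨
      ∑ (λ j → - laplaceTerm A j)
    ≈⟨ -‿∑ (laplaceTerm A) ⟨
      - det A ∎

  det-swapColumns : (k : Fin m) (A : Matrix (suc m)) → det (swapColumns k A) ≈ - det A
  det-swapColumns k A = begin
    det (swapColumns k A)          ≈⟨ det-transpose (swapColumns k A) ⟨
    det (swapRows k (transpose A)) ≈⟨ det-swapRows k (transpose A) ⟩
    - det (transpose A)            ≈⟨ -‿cong (det-transpose A) ⟩
    - det A                        ∎

  det-swapRowsAndColumns : (k : Fin m) (A : Matrix (suc m)) → det (swapRows k (swapColumns k A)) ≈ det A
  det-swapRowsAndColumns k A = begin
    det (swapRows k (swapColumns k A)) ≈⟨ det-swapRows k (swapColumns k A) ⟩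
    - det (swapColumns k A)            ≈⟨ -‿cong (det-swapColumns k A) ⟩
    - - det A                          ≈⟨ -‿involutive (det A) ⟩
    det A                              ∎

  private
    x+y*0≈x : ∀ x y {e} → e ≈ 0# → x + y * e ≈ x
    x+y*0≈x x y e≈0 = trans (+-congˡ (trans (*-congˡ e≈0) (zeroʳ y))) (+-identityʳ x)

  det-affineInRow : (A E : Matrix n) (r : Fin n) → (∀ i j → i ≢ r → E i j ≈ 0#) →
    ∃[ γ ] ∀ x → det (λ i j → A i j + x * E i j) ≈ det A + x * γ
  det-affineInRow {suc n} A E zero E≈0 = ∑ (λ j → (sign (toℕ j) * E zero j) * det (minor j A)) , λ x → begin
      ∑ (λ j → (sign (toℕ j) * (A zero j + x * E zero j)) * det (minor j λ i j → A i j + x * E i j))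
    ≈⟨ ∑-cong (λ j → *-congˡ (det-cong λ a b → x+y*0≈x _ x (E≈0 (suc a) (punchIn j b) λ ()))) ⟩
      ∑ (λ j → (sign (toℕ j) * (A zero j + x * E zero j)) * det (minor j A))
    ≈⟨ ∑-cong (λ j → split (sign (toℕ j)) (A zero j) x (E zero j) (det (minor j A))) ⟩
      ∑ (λ j → laplaceTerm A j + x * ((sign (toℕ j) * E zero j) * det (minor j A)))
    ≈⟨ ∑-affine (laplaceTerm A) _ x ⟩
      det A + x * ∑ (λ j → (sign (toℕ j) * E zero j) * det (minor j A)) ∎
    where
    split : ∀ s a x e M → (s * (a + x * e)) * M ≈ (s * a) * M + x * ((s * e) * M)
    split s a x e M = begin
      (s * (a + x * e)) * M           ≈⟨ *-congʳ (distribˡ s a (x * e)) ⟩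
      (s * a + s * (x * e)) * M       ≈⟨ distribʳ M (s * a) (s * (x * e)) ⟩
      (s * a) * M + (s * (x * e)) * M ≈⟨ +-congˡ (*-congʳ (x*[y*z]≈y*[x*z] s x e)) ⟩
      (s * a) * M + (x * (s * e)) * M ≈⟨ +-congˡ (*-assoc x (s * e) M) ⟩
      (s * a) * M + x * ((s * e) * M) ∎
  det-affineInRow {suc n} A E (suc r) E≈0 = ∑ (λ j → (sign (toℕ j) * A zero j) * γ j) , λ x → begin
      ∑ (λ j → (sign (toℕ j) * (A zero j + x * E zero j)) * det λ a b → minor j A a b + x * minor j E a b)
    ≈⟨ ∑-cong (λ j → *-cong (*-congˡ (x+y*0≈x _ x (E≈0 zero j λ ()))) (proj₂ (minor-affine j) x)) ⟩
      ∑ (λ j → (sign (toℕ j) * A zero j) * (det (minor j A) + x * γ j))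
    ≈⟨ ∑-cong (λ j → split (sign (toℕ j) * A zero j) (det (minor j A)) x (γ j)) ⟩
      ∑ (λ j → laplaceTerm A j + x * ((sign (toℕ j) * A zero j) * γ j))
    ≈⟨ ∑-affine (laplaceTerm A) _ x ⟩
      det A + x * ∑ (λ j → (sign (toℕ j) * A zero j) * γ j) ∎
    where
    minor-affine : ∀ j → ∃[ γ ] ∀ x →
      det (λ a b → minor j A a b + x * minor j E a b) ≈ det (minor j A) + x * γ
    minor-affine j = det-affineInRow (minor j A) (minor j E) r
      λ a b a≢r → E≈0 (suc a) (punchIn j b) (a≢r ∘ suc-injective)
    γ : Fin (suc n) → Carrier
    γ j = proj₁ (minor-affine j)
    split : ∀ p M x γ → p * (M + x * γ) ≈ p * M + x * (p * γ)
    split p M x γ = trans (distribˡ p M (x * γ)) (+-congˡ (x*[y*z]≈y*[x*z] p x γ))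

  private
    opposite-shifts : ∀ u a q → (u + a * q) + (u + - a * q) ≈ 2 × u
    opposite-shifts u a q = begin
      (u + a * q) + (u + - a * q)   ≈⟨ interchange u (a * q) u (- a * q) ⟩
      (u + u) + (a * q + - a * q)   ≈⟨ +-congˡ (+-congˡ (-‿distribˡ-* a q)) ⟨
      (u + u) + (a * q + - (a * q)) ≈⟨ +-congˡ (-‿inverseʳ (a * q)) ⟩
      (u + u) + 0#                  ≈⟨ +-identityʳ (u + u) ⟩
      u + u                         ≈⟨ +-congˡ (+-identityʳ u) ⟨
      2 × u                         ∎

    shift-by-twice : ∀ u a q → u + a * q ≈ (u + - a * q) + 2 × (a * q)
    shift-by-twice u a q = sym (begin
      (u + - a * q) + (a * q + (a * q + 0#))   ≈⟨ +-assoc u (- a * q) _ ⟩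
      u + (- a * q + (a * q + (a * q + 0#)))   ≈⟨ +-congˡ (+-assoc (- a * q) (a * q) _) ⟨
      u + ((- a * q + a * q) + (a * q + 0#))   ≈⟨ +-congˡ (+-congʳ (+-congʳ (-‿distribˡ-* a q))) ⟨
      u + ((- (a * q) + a * q) + (a * q + 0#)) ≈⟨ +-congˡ (+-congʳ (-‿inverseˡ (a * q))) ⟩
      u + (0# + (a * q + 0#))                  ≈⟨ +-congˡ (+-identityˡ _) ⟩
      u + (a * q + 0#)                         ≈⟨ +-congˡ (+-identityʳ (a * q)) ⟩
      u + a * q                                ∎)

  -- Being affine in x and symmetric, F x y = c + (x + y) * p 0# + x * y * q for some c and q,
  -- and only the linear part differs between (a, a) and (- a, - a).
  symmetric-affine-flip : (F : Carrier → Carrier → Carrier) (p : Carrier → Carrier) →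
    (∀ x y → F x y ≈ F 0# y + x * p y) → (∀ x y → F x y ≈ F y x) →
    ∀ a → F a a ≈ F (- a) (- a) + 4 × (a * p 0#)
  symmetric-affine-flip F p affine symm a = +-cancelʳ (F (- a) a) _ _ (begin
      F a a + F (- a) a
    ≈⟨ +-cong (affine a a) (affine (- a) a) ⟩
      (U + a * p a) + (U + - a * p a)
    ≈⟨ opposite-shifts U a (p a) ⟩
      2 × U
    ≈⟨ ×-congʳ 2 U≈V+2t ⟩
      2 × (V + 2 × t)
    ≈⟨ ×-distrib-+ V (2 × t) 2 ⟩
      2 × V + 2 × (2 × t)
    ≈⟨ +-cong (opposite-shifts V a (p (- a))) (sym (×-assocˡ t 2 2)) ⟨
      ((V + a * p (- a)) + (V + - a * p (- a))) + 4 × t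
    ≈⟨ +-congʳ (+-cong (trans (symm (- a) a) (affine a (- a))) (affine (- a) (- a))) ⟨
      (F (- a) a + F (- a) (- a)) + 4 × t
    ≈⟨ xy∙z≈yz∙x _ _ _ ⟩
      (F (- a) (- a) + 4 × t) + F (- a) a ∎)
    where
    U V t : Carrier
    U = F 0# a
    V = F 0# (- a)
    t = a * p 0#
    U≈V+2t : U ≈ V + 2 × t
    U≈V+2t = begin
      F 0# a                         ≈⟨ trans (symm 0# a) (affine a 0#) ⟩
      F 0# 0# + a * p 0#             ≈⟨ shift-by-twice (F 0# 0#) a (p 0#) ⟩
      (F 0# 0# + - a * p 0#) + 2 × t ≈⟨ +-congʳ (trans (symm 0# (- a)) (affine (- a) 0#)) ⟨
      F 0# (- a) + 2 × t             ∎

  det-symmetricPerturbation : (S E : Matrix n) (r : Fin n) →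
    (∀ i j → S i j ≈ S j i) → (∀ i j → i ≢ r → E i j ≈ 0#) →
    ∃[ z ] det (λ i j → S i j + (E i j + E j i)) ≈ det (λ i j → S i j - (E i j + E j i)) + 4 × z
  det-symmetricPerturbation S E r S-sym E≈0 = 1# * p 0# , (begin
      det (λ i j → S i j + (E i j + E j i))
    ≈⟨ det-cong (λ i j → trans (x∙yz≈xz∙y (S i j) (E i j) (E j i))
                               (+-cong (+-congˡ (sym (*-identityˡ (E j i)))) (sym (*-identityˡ (E i j))))) ⟩
      F 1# 1#
    ≈⟨ symmetric-affine-flip F p affine symmetric 1# ⟩
      F (- 1#) (- 1#) + 4 × (1# * p 0#)
    ≈⟨ +-congʳ (det-cong λ i j → begin
         S i j - (E i j + E j i)               ≈⟨ +-congˡ (-‿anti-homo-+ (E i j) (E j i)) ⟩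
         S i j + (- E j i + - E i j)           ≈⟨ +-assoc (S i j) (- E j i) (- E i j) ⟨
         (S i j + - E j i) + - E i j           ≈⟨ +-cong (+-congˡ (-1*x≈-x (E j i))) (-1*x≈-x (E i j)) ⟨
         (S i j + - 1# * E j i) + - 1# * E i j ∎) ⟨
      det (λ i j → S i j - (E i j + E j i)) + 4 × (1# * p 0#) ∎)
    where
    A : Carrier → Matrix _
    A y i j = S i j + y * E j i
    F : Carrier → Carrier → Carrier
    F x y = det (λ i j → A y i j + x * E i j)
    p : Carrier → Carrier
    p y = proj₁ (det-affineInRow (A y) E r E≈0)
    affine : ∀ x y → F x y ≈ F 0# y + x * p y
    affine x y = begin
        F x y
      ≈⟨ proj₂ (det-affineInRow (A y) E r E≈0) x ⟩
        det (A y) + x * p y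
      ≈⟨ +-congʳ (det-cong λ i j → trans (+-congˡ (zeroˡ (E i j))) (+-identityʳ (A y i j))) ⟨
        F 0# y + x * p y ∎
    symmetric : ∀ x y → F x y ≈ F y x
    symmetric x y = trans (sym (det-transpose λ i j → A y i j + x * E i j)) (det-cong λ i j →
      trans (xy∙z≈xz∙y (S j i) (y * E i j) (x * E j i)) (+-congʳ (+-congʳ (S-sym j i))))

  adjacentEntry : Fin m → Matrix (suc m) → Matrix (suc m)
  adjacentEntry zero    A zero    (suc zero) = A zero (suc zero)
  adjacentEntry (suc k) A (suc i) (suc j)    = adjacentEntry k (λ a b → A (suc a) (suc b)) i j
  adjacentEntry _       _ _       _          = 0#

  adjacentEntry-offRow : (k : Fin m) (A : Matrix (suc m)) →
    ∀ i j → i ≢ inject₁ k → adjacentEntry k A i j ≈ 0#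
  adjacentEntry-offRow zero    A zero    j       0≢0 = contradiction ≡.refl 0≢0
  adjacentEntry-offRow zero    A (suc i) j       _   = refl
  adjacentEntry-offRow (suc k) A zero    j       _   = refl
  adjacentEntry-offRow (suc k) A (suc i) zero    _   = refl
  adjacentEntry-offRow (suc k) A (suc i) (suc j) i≢k =
    adjacentEntry-offRow k (λ a b → A (suc a) (suc b)) i j (i≢k ∘ ≡.cong suc)

  negateAdjacentPair : Fin m → Matrix (suc m) → Matrix (suc m)
  negateAdjacentPair zero    A zero       (suc zero) = - A zero (suc zero)
  negateAdjacentPair zero    A (suc zero) zero       = - A (suc zero) zero
  negateAdjacentPair (suc k) A (suc i)    (suc j)    = negateAdjacentPair k (λ a b → A (suc a) (suc b)) i j
  negateAdjacentPair _       A i          j          = A i j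

  private
    x-d-d≈x : ∀ {x d} → d ≈ 0# → (x - d) - d ≈ x
    x-d-d≈x {x} {d} d≈0 = begin
      (x - d) - d   ≈⟨ +-cong (+-congˡ (-‿cong d≈0)) (-‿cong d≈0) ⟩
      (x - 0#) - 0# ≈⟨ +-cong (+-congˡ -0#≈0#) -0#≈0# ⟩
      (x + 0#) + 0# ≈⟨ trans (+-identityʳ _) (+-identityʳ x) ⟩
      x             ∎

    x-d-d≈-x : ∀ {x d} → d ≈ x → (x - d) - d ≈ - x
    x-d-d≈-x {x} {d} d≈x = begin
      (x - d) - d ≈⟨ +-cong (+-congˡ (-‿cong d≈x)) (-‿cong d≈x) ⟩
      (x - x) - x ≈⟨ +-congʳ (-‿inverseʳ x) ⟩
      0# - x      ≈⟨ +-identityˡ (- x) ⟩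
      - x         ∎

    0+0≈0 : 0# + 0# ≈ 0#
    0+0≈0 = +-identityʳ 0#

    negateAdjacentPair-viaEntries : (k : Fin m) (S : Matrix (suc m)) → (∀ i j → S i j ≈ S j i) →
      let E = adjacentEntry k S in
      ∀ i j → negateAdjacentPair k S i j ≈ (S i j - (E i j + E j i)) - (E i j + E j i)
    negateAdjacentPair-viaEntries zero    S S-sym zero          zero          = sym (x-d-d≈x 0+0≈0)
    negateAdjacentPair-viaEntries zero    S S-sym zero          (suc zero)    = sym (x-d-d≈-x (+-identityʳ _))
    negateAdjacentPair-viaEntries zero    S S-sym zero          (suc (suc j)) = sym (x-d-d≈x 0+0≈0)
    negateAdjacentPair-viaEntries zero    S S-sym (suc zero)    zero          =
      sym (x-d-d≈-x (trans (+-identityˡ _) (S-sym _ _)))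
    negateAdjacentPair-viaEntries zero    S S-sym (suc zero)    (suc j)       = sym (x-d-d≈x 0+0≈0)
    negateAdjacentPair-viaEntries zero    S S-sym (suc (suc i)) zero          = sym (x-d-d≈x 0+0≈0)
    negateAdjacentPair-viaEntries zero    S S-sym (suc (suc i)) (suc j)       = sym (x-d-d≈x 0+0≈0)
    negateAdjacentPair-viaEntries (suc k) S S-sym zero          zero          = sym (x-d-d≈x 0+0≈0)
    negateAdjacentPair-viaEntries (suc k) S S-sym zero          (suc j)       = sym (x-d-d≈x 0+0≈0)
    negateAdjacentPair-viaEntries (suc k) S S-sym (suc i)       zero          = sym (x-d-d≈x 0+0≈0)
    negateAdjacentPair-viaEntries (suc k) S S-sym (suc i)       (suc j)       =
      negateAdjacentPair-viaEntries k (λ a b → S (suc a) (suc b)) (λ a b → S-sym (suc a) (suc b)) i j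

  det-negateAdjacentPair : (k : Fin m) (S : Matrix (suc m)) → (∀ i j → S i j ≈ S j i) →
    ∃[ z ] det S ≈ det (negateAdjacentPair k S) + 4 × z
  det-negateAdjacentPair k S S-sym =
    let z , eq = det-symmetricPerturbation S₀ E (inject₁ k) S₀-sym (adjacentEntry-offRow k S)
    in z , (begin
      det S                                ≈⟨ det-cong (λ i j → //-rightDividesˡ (D i j) (S i j)) ⟨
      det (λ i j → S₀ i j + D i j)         ≈⟨ eq ⟩
      det (λ i j → S₀ i j - D i j) + 4 × z ≈⟨ +-congʳ (det-cong (negateAdjacentPair-viaEntries k S S-sym)) ⟨
      det (negateAdjacentPair k S) + 4 × z ∎)
    where
    E D S₀ : Matrix _
    E = adjacentEntry k S
    D i j = E i j + E j i
    S₀ i j = S i j - D i j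
    S₀-sym : ∀ i j → S₀ i j ≈ S₀ j i
    S₀-sym i j = +-cong (S-sym i j) (-‿cong (+-comm (E i j) (E j i)))

-- Formal ℤ-combinations of square roots

module RootSums where

  open Defs using (Root; rmul)
  open import Data.Integer using (_+_; _*_; -_)
  open ≡ using (refl; sym; trans; cong; cong₂; module ≡-Reasoning)

  evalAt : (ℕ → ℤ) → List Root → ℤ
  evalAt w []            = 0ℤ
  evalAt w ((c , r) ∷ L) = c * w r + evalAt w L

  infix 4 _≈ᵣ_
  record _≈ᵣ_ (L L′ : List Root) : Set where
    constructor evaluations-≡
    field
      evalAt-≡ : ∀ w → evalAt w L ≡ evalAt w L′

  open _≈ᵣ_ public

  negate : List Root → List Root
  negate = List.map (map₁ -_)

  infixl 7 _⊛_
  _⊛_ : List Root → List Root → List Root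
  []      ⊛ L′ = []
  (x ∷ L) ⊛ L′ = List.map (rmul x) L′ ++ L ⊛ L′

  one : List Root
  one = [ ℤ.1ℤ , 1 ]

  evalAt-++ : ∀ w L L′ → evalAt w (L ++ L′) ≡ evalAt w L + evalAt w L′
  evalAt-++ w []            L′ = sym (ℤ.+-identityˡ _)
  evalAt-++ w ((c , r) ∷ L) L′ =
    trans (cong (_+_ (c * w r)) (evalAt-++ w L L′)) (sym (ℤ.+-assoc (c * w r) _ _))

  evalAt-negate : ∀ w L → evalAt w (negate L) ≡ - evalAt w L
  evalAt-negate w []            = refl
  evalAt-negate w ((c , r) ∷ L) = begin
    - c * w r + evalAt w (negate L) ≡⟨ cong₂ _+_ (ℤ.neg-distribˡ-* c (w r)) (sym (evalAt-negate w L)) ⟨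
    - (c * w r) + - evalAt w L      ≡⟨ ℤ.neg-distrib-+ (c * w r) (evalAt w L) ⟨
    - (c * w r + evalAt w L)        ∎
    where open ≡-Reasoning

  evalAt-congʷ : ∀ {w w′} → (∀ r → w r ≡ w′ r) → ∀ L → evalAt w L ≡ evalAt w′ L
  evalAt-congʷ w≗w′ []            = refl
  evalAt-congʷ w≗w′ ((c , r) ∷ L) = cong₂ _+_ (cong (c *_) (w≗w′ r)) (evalAt-congʷ w≗w′ L)

  evalAt-0ʷ : ∀ L → evalAt (λ _ → 0ℤ) L ≡ 0ℤ
  evalAt-0ʷ []            = refl
  evalAt-0ʷ ((c , r) ∷ L) = cong₂ _+_ (ℤ.*-zeroʳ c) (evalAt-0ʷ L)

  evalAt-+ʷ : ∀ f g L → evalAt (λ r → f r + g r) L ≡ evalAt f L + evalAt g L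
  evalAt-+ʷ f g []            = refl
  evalAt-+ʷ f g ((c , r) ∷ L) =
    trans (cong (_+_ (c * (f r + g r))) (evalAt-+ʷ f g L)) (rearrange c (f r) (g r) _ _)
    where
    rearrange : ∀ c x y e h → c * (x + y) + (e + h) ≡ (c * x + e) + (c * y + h)
    rearrange = solve-∀

  evalAt-*ʷ : ∀ a f L → evalAt (λ r → a * f r) L ≡ a * evalAt f L
  evalAt-*ʷ a f []            = sym (ℤ.*-zeroʳ a)
  evalAt-*ʷ a f ((c , r) ∷ L) =
    trans (cong (_+_ (c * (a * f r))) (evalAt-*ʷ a f L)) (rearrange c a (f r) _)
    where
    rearrange : ∀ c a x e → c * (a * x) + a * e ≡ a * (c * x + e)
    rearrange = solve-∀

  evalAt-swap : ∀ (F : ℕ → ℕ → ℤ) L L′ →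
    evalAt (λ r → evalAt (F r) L′) L ≡ evalAt (λ s → evalAt (λ r → F r s) L) L′
  evalAt-swap F []            L′ = sym (evalAt-0ʷ L′)
  evalAt-swap F ((c , r) ∷ L) L′ = begin
      c * evalAt (F r) L′ + evalAt (λ r → evalAt (F r) L′) L
    ≡⟨ cong (_+_ (c * evalAt (F r) L′)) (evalAt-swap F L L′) ⟩
      c * evalAt (F r) L′ + evalAt (λ s → evalAt (λ r → F r s) L) L′
    ≡⟨ cong (_+ _) (evalAt-*ʷ c (F r) L′) ⟨
      evalAt (λ s → c * F r s) L′ + evalAt (λ s → evalAt (λ r → F r s) L) L′
    ≡⟨ evalAt-+ʷ _ _ L′ ⟨
      evalAt (λ s → c * F r s + evalAt (λ r → F r s) L) L′ ∎
    where open ≡-Reasoning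

  evalAt-map-rmul : ∀ w c r L → evalAt w (List.map (rmul (c , r)) L) ≡ c * evalAt (λ s → w (r ℕ.* s)) L
  evalAt-map-rmul w c r []             = sym (ℤ.*-zeroʳ c)
  evalAt-map-rmul w c r ((c′ , s) ∷ L) =
    trans (cong (_+_ (c * c′ * w (r ℕ.* s))) (evalAt-map-rmul w c r L)) (rearrange c c′ _ _)
    where
    rearrange : ∀ c c′ x e → c * c′ * x + c * e ≡ c * (c′ * x + e)
    rearrange = solve-∀

  evalAt-⊛ : ∀ w L L′ → evalAt w (L ⊛ L′) ≡ evalAt (λ r → evalAt (λ s → w (r ℕ.* s)) L′) L
  evalAt-⊛ w []            L′ = refl
  evalAt-⊛ w ((c , r) ∷ L) L′ = begin
      evalAt w (List.map (rmul (c , r)) L′ ++ L ⊛ L′)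
    ≡⟨ evalAt-++ w (List.map (rmul (c , r)) L′) (L ⊛ L′) ⟩
      evalAt w (List.map (rmul (c , r)) L′) + evalAt w (L ⊛ L′)
    ≡⟨ cong₂ _+_ (evalAt-map-rmul w c r L′) (evalAt-⊛ w L L′) ⟩
      c * evalAt (λ s → w (r ℕ.* s)) L′ + evalAt (λ r → evalAt (λ s → w (r ℕ.* s)) L′) L ∎
    where open ≡-Reasoning

  private
    variable
      L L′ L″ L₁ L₂ L₃ L₄ : List Root

  ++-cong : L₁ ≈ᵣ L₂ → L₃ ≈ᵣ L₄ → L₁ ++ L₃ ≈ᵣ L₂ ++ L₄
  ++-cong {L₁} {L₂} {L₃} {L₄} L₁≈L₂ L₃≈L₄ = evaluations-≡ λ w → begin
    evalAt w (L₁ ++ L₃)       ≡⟨ evalAt-++ w L₁ L₃ ⟩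
    evalAt w L₁ + evalAt w L₃ ≡⟨ cong₂ _+_ (evalAt-≡ L₁≈L₂ w) (evalAt-≡ L₃≈L₄ w) ⟩
    evalAt w L₂ + evalAt w L₄ ≡⟨ evalAt-++ w L₂ L₄ ⟨
    evalAt w (L₂ ++ L₄)       ∎
    where open ≡-Reasoning

  ++-comm-≈ᵣ : ∀ L L′ → L ++ L′ ≈ᵣ L′ ++ L
  ++-comm-≈ᵣ L L′ = evaluations-≡ λ w → begin
    evalAt w (L ++ L′)        ≡⟨ evalAt-++ w L L′ ⟩
    evalAt w L + evalAt w L′  ≡⟨ ℤ.+-comm (evalAt w L) (evalAt w L′) ⟩
    evalAt w L′ + evalAt w L  ≡⟨ evalAt-++ w L′ L ⟨
    evalAt w (L′ ++ L)        ∎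
    where open ≡-Reasoning

  negate-cong : L ≈ᵣ L′ → negate L ≈ᵣ negate L′
  negate-cong {L} {L′} L≈L′ = evaluations-≡ λ w → begin
    evalAt w (negate L)  ≡⟨ evalAt-negate w L ⟩
    - evalAt w L         ≡⟨ cong -_ (evalAt-≡ L≈L′ w) ⟩
    - evalAt w L′        ≡⟨ evalAt-negate w L′ ⟨
    evalAt w (negate L′) ∎
    where open ≡-Reasoning

  negate-inverseˡ : ∀ L → negate L ++ L ≈ᵣ []
  negate-inverseˡ L = evaluations-≡ λ w → begin
    evalAt w (negate L ++ L)           ≡⟨ evalAt-++ w (negate L) L ⟩
    evalAt w (negate L) + evalAt w L   ≡⟨ cong (_+ evalAt w L) (evalAt-negate w L) ⟩
    - evalAt w L + evalAt w L          ≡⟨ ℤ.+-inverseˡ (evalAt w L) ⟩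
    0ℤ                                 ∎
    where open ≡-Reasoning

  negate-inverseʳ : ∀ L → L ++ negate L ≈ᵣ []
  negate-inverseʳ L = evaluations-≡ λ w →
    trans (evalAt-≡ (++-comm-≈ᵣ L (negate L)) w) (evalAt-≡ (negate-inverseˡ L) w)

  ⊛-cong : L₁ ≈ᵣ L₂ → L₃ ≈ᵣ L₄ → L₁ ⊛ L₃ ≈ᵣ L₂ ⊛ L₄
  ⊛-cong {L₁} {L₂} {L₃} {L₄} L₁≈L₂ L₃≈L₄ = evaluations-≡ λ w → begin
    evalAt w (L₁ ⊛ L₃)                              ≡⟨ evalAt-⊛ w L₁ L₃ ⟩
    evalAt (λ r → evalAt (λ s → w (r ℕ.* s)) L₃) L₁ ≡⟨ evalAt-≡ L₁≈L₂ _ ⟩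
    evalAt (λ r → evalAt (λ s → w (r ℕ.* s)) L₃) L₂ ≡⟨ evalAt-congʷ (λ r → evalAt-≡ L₃≈L₄ _) L₂ ⟩
    evalAt (λ r → evalAt (λ s → w (r ℕ.* s)) L₄) L₂ ≡⟨ evalAt-⊛ w L₂ L₄ ⟨
    evalAt w (L₂ ⊛ L₄)                              ∎
    where open ≡-Reasoning

  ⊛-assoc : ∀ L₁ L₂ L₃ → (L₁ ⊛ L₂) ⊛ L₃ ≈ᵣ L₁ ⊛ (L₂ ⊛ L₃)
  ⊛-assoc L₁ L₂ L₃ = evaluations-≡ λ w → begin
      evalAt w ((L₁ ⊛ L₂) ⊛ L₃)
    ≡⟨ trans (evalAt-⊛ w (L₁ ⊛ L₂) L₃) (evalAt-⊛ _ L₁ L₂) ⟩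
      evalAt (λ r → evalAt (λ s → evalAt (λ t → w ((r ℕ.* s) ℕ.* t)) L₃) L₂) L₁
    ≡⟨ evalAt-congʷ (λ r → evalAt-congʷ (λ s → evalAt-congʷ (λ t → cong w (ℕ.*-assoc r s t)) L₃) L₂) L₁ ⟩
      evalAt (λ r → evalAt (λ s → evalAt (λ t → w (r ℕ.* (s ℕ.* t))) L₃) L₂) L₁
    ≡⟨ trans (evalAt-⊛ w L₁ (L₂ ⊛ L₃)) (evalAt-congʷ (λ r → evalAt-⊛ _ L₂ L₃) L₁) ⟨
      evalAt w (L₁ ⊛ (L₂ ⊛ L₃)) ∎
    where open ≡-Reasoning

  ⊛-comm : ∀ L L′ → L ⊛ L′ ≈ᵣ L′ ⊛ L
  ⊛-comm L L′ = evaluations-≡ λ w → begin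
      evalAt w (L ⊛ L′)
    ≡⟨ evalAt-⊛ w L L′ ⟩
      evalAt (λ r → evalAt (λ s → w (r ℕ.* s)) L′) L
    ≡⟨ evalAt-swap (λ r s → w (r ℕ.* s)) L L′ ⟩
      evalAt (λ s → evalAt (λ r → w (r ℕ.* s)) L) L′
    ≡⟨ evalAt-congʷ (λ s → evalAt-congʷ (λ r → cong w (ℕ.*-comm r s)) L) L′ ⟩
      evalAt (λ s → evalAt (λ r → w (s ℕ.* r)) L) L′
    ≡⟨ evalAt-⊛ w L′ L ⟨
      evalAt w (L′ ⊛ L) ∎
    where open ≡-Reasoning

  ⊛-identityʳ : ∀ L → L ⊛ one ≈ᵣ L
  ⊛-identityʳ L = evaluations-≡ λ w → trans (evalAt-⊛ w L one) (evalAt-congʷ (unit w) L)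
    where
    unit : ∀ w r → ℤ.1ℤ * w (r ℕ.* 1) + 0ℤ ≡ w r
    unit w r = trans (ℤ.+-identityʳ _) (trans (ℤ.*-identityˡ _) (cong w (ℕ.*-identityʳ r)))

  ⊛-identityˡ : ∀ L → one ⊛ L ≈ᵣ L
  ⊛-identityˡ L = evaluations-≡ λ w → trans (evalAt-≡ (⊛-comm one L) w) (evalAt-≡ (⊛-identityʳ L) w)

  ⊛-distribʳ : ∀ L L′ L″ → (L′ ++ L″) ⊛ L ≈ᵣ L′ ⊛ L ++ L″ ⊛ L
  ⊛-distribʳ L L′ L″ = evaluations-≡ λ w → let g = λ r → evalAt (λ s → w (r ℕ.* s)) L in begin
    evalAt w ((L′ ++ L″) ⊛ L)             ≡⟨ evalAt-⊛ w (L′ ++ L″) L ⟩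
    evalAt g (L′ ++ L″)                   ≡⟨ evalAt-++ g L′ L″ ⟩
    evalAt g L′ + evalAt g L″             ≡⟨ cong₂ _+_ (evalAt-⊛ w L′ L) (evalAt-⊛ w L″ L) ⟨
    evalAt w (L′ ⊛ L) + evalAt w (L″ ⊛ L) ≡⟨ evalAt-++ w (L′ ⊛ L) (L″ ⊛ L) ⟨
    evalAt w (L′ ⊛ L ++ L″ ⊛ L)           ∎
    where open ≡-Reasoning

  ⊛-distribˡ : ∀ L L′ L″ → L ⊛ (L′ ++ L″) ≈ᵣ L ⊛ L′ ++ L ⊛ L″
  ⊛-distribˡ L L′ L″ = evaluations-≡ λ w → begin
    evalAt w (L ⊛ (L′ ++ L″))   ≡⟨ evalAt-≡ (⊛-comm L (L′ ++ L″)) w ⟩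
    evalAt w ((L′ ++ L″) ⊛ L)   ≡⟨ evalAt-≡ (⊛-distribʳ L L′ L″) w ⟩
    evalAt w (L′ ⊛ L ++ L″ ⊛ L) ≡⟨ evalAt-≡ (++-cong (⊛-comm L′ L) (⊛-comm L″ L)) w ⟩
    evalAt w (L ⊛ L′ ++ L ⊛ L″) ∎
    where open ≡-Reasoning

  rootSumRing : CommutativeRing 0ℓ 0ℓ
  rootSumRing = record
    { Carrier = List Root
    ; _≈_ = _≈ᵣ_
    ; _+_ = _++_
    ; _*_ = _⊛_
    ; -_ = negate
    ; 0# = []
    ; 1# = one
    ; isCommutativeRing = record
      { isRing = record
        { +-isAbelianGroup = record
          { isGroup = record
            { isMonoid = record
              { isSemigroup = record
                { isMagma = record
                  { isEquivalence = record
                    { refl  = evaluations-≡ λ _ → refl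
                    ; sym   = λ p → evaluations-≡ λ w → sym (evalAt-≡ p w)
                    ; trans = λ p q → evaluations-≡ λ w → trans (evalAt-≡ p w) (evalAt-≡ q w) }
                  ; ∙-cong = ++-cong }
                ; assoc = λ L₁ L₂ L₃ → evaluations-≡ λ w → cong (evalAt w) (List.++-assoc L₁ L₂ L₃) }
              ; identity = (λ L → evaluations-≡ λ _ → refl)
                         , (λ L → evaluations-≡ λ w → cong (evalAt w) (List.++-identityʳ L)) }
            ; inverse = negate-inverseˡ , negate-inverseʳ
            ; ⁻¹-cong = negate-cong }
          ; comm = ++-comm-≈ᵣ }
        ; *-cong = ⊛-cong
        ; *-assoc = ⊛-assoc
        ; *-identity = ⊛-identityˡ , ⊛-identityʳ
        ; distrib = ⊛-distribˡ , ⊛-distribʳ }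
      ; *-comm = ⊛-comm } }

open Defs
open RootSums
module D = Determinant rootSumRing
module R = CommutativeRing rootSumRing
open import Data.Integer using (_+_; _*_; -_; _-_)
open ≡ using (refl; sym; trans; cong; cong₂)
open ≡.≡-Reasoning

infix 4 _≡_mod_
record _≡_mod_ (a b : ℤ) (d : ℕ) : Set where
  constructor congruent
  field
    quotient : ℤ
    equality : a ≡ b + + d * quotient

mod-refl : ∀ {a d} → a ≡ a mod d
mod-refl {a} {d} = congruent 0ℤ (sym (trans (cong (_+_ a) (ℤ.*-zeroʳ (+ d))) (ℤ.+-identityʳ a)))

mod-trans : ∀ {a b c d} → a ≡ b mod d → b ≡ c mod d → a ≡ c mod d
mod-trans {a} {b} {c} {d} (congruent t a≡b+dt) (congruent u b≡c+du) = congruent (u + t) (begin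
  a                         ≡⟨ a≡b+dt ⟩
  b + + d * t               ≡⟨ cong (λ x → x + + d * t) b≡c+du ⟩
  c + + d * u + + d * t     ≡⟨ regroup c (+ d) u t ⟩
  c + + d * (u + t)         ∎)
  where
  regroup : ∀ c d u t → c + d * u + d * t ≡ c + d * (u + t)
  regroup = solve-∀

remainder-unique : ∀ {d r r′} → r ℕ.< d → r′ ℕ.< d → ∀ q → + r ≡ + r′ + + d * q → r ≡ r′
remainder-unique {d} {r} {r′} r<d r′<d (+ zero) eq =
  ℤ.+-injective (trans eq (trans (cong (_+_ (+ r′)) (ℤ.*-zeroʳ (+ d))) (ℤ.+-identityʳ (+ r′))))
remainder-unique {d} {r} {r′} r<d r′<d +[1+ k ] eq = ⊥-elim (ℕ.<⇒≱ r<d d≤r)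
  where
  r≡r′+d[1+k] : r ≡ r′ ℕ.+ d ℕ.* suc k
  r≡r′+d[1+k] = ℤ.+-injective (trans eq (trans (cong (_+_ (+ r′)) (sym (ℤ.pos-* d (suc k))))
                                              (sym (ℤ.pos-+ r′ _))))
  d≤r : d ℕ.≤ r
  d≤r = ℕ.≤-trans (ℕ.m≤m*n d (suc k))
                  (ℕ.≤-trans (ℕ.m≤n+m _ r′) (ℕ.≤-reflexive (sym r≡r′+d[1+k])))
remainder-unique {d} {r} {r′} r<d r′<d -[1+ k ] eq = sym (remainder-unique r′<d r<d +[1+ k ] (begin
  + r′                        ≡⟨ isolate (+ r) (+ r′) (+ d * -[1+ k ]) eq ⟩
  + r - + d * -[1+ k ]        ≡⟨ cong (_+_ (+ r)) (ℤ.neg-distribʳ-* (+ d) -[1+ k ]) ⟩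
  + r + + d * +[1+ k ]        ∎))
  where
  isolate : ∀ x y e → x ≡ y + e → y ≡ x - e
  isolate x y e x≡y+e = trans (cancel y e) (cong (_- e) (sym x≡y+e))
    where
    cancel : ∀ y e → y ≡ y + e - e
    cancel = solve-∀

mod⇒%ℕ≡ : ∀ {a b d} ⦃ _ : NonZero d ⦄ → a ≡ b mod d → a %ℕ d ≡ b %ℕ d
mod⇒%ℕ≡ {a} {b} {d} (congruent t a≡b+dt) =
  remainder-unique (n%ℕd<d a d) (n%ℕd<d b d) (b /ℕ d + t - a /ℕ d) (begin
      + (a %ℕ d)
    ≡⟨ cancel (+ (a %ℕ d)) (a /ℕ d * + d) ⟩
      + (a %ℕ d) + a /ℕ d * + d - a /ℕ d * + d
    ≡⟨ cong (_- a /ℕ d * + d) (a≡a%ℕn+[a/ℕn]*n a d) ⟨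
      a - a /ℕ d * + d
    ≡⟨ cong (_- a /ℕ d * + d) a≡b+dt ⟩
      b + + d * t - a /ℕ d * + d
    ≡⟨ cong (λ x → x + + d * t - a /ℕ d * + d) (a≡a%ℕn+[a/ℕn]*n b d) ⟩
      + (b %ℕ d) + b /ℕ d * + d + + d * t - a /ℕ d * + d
    ≡⟨ regroup (+ (b %ℕ d)) (b /ℕ d) (a /ℕ d) t (+ d) ⟩
      + (b %ℕ d) + + d * (b /ℕ d + t - a /ℕ d) ∎)
  where
  cancel : ∀ x y → x ≡ x + y - y
  cancel = solve-∀
  regroup : ∀ r q q′ t d → r + q * d + d * t - q′ * d ≡ r + d * (q + t - q′)
  regroup = solve-∀

-- det 𝔖(B) as a formal determinant

formal : (Fin n → Fin n → Root) → D.Matrix n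
formal M i j = [ M i j ]

sign≡alt : ∀ k → D.sign k ≡ [ alt k , 1 ]
sign≡alt zero    = refl
sign≡alt (suc k) = cong negate (sign≡alt k)

concatMap-tabulate : ∀ {A : Set} (f : A → List Root) (g : Fin n → A) →
  List.concatMap f (List.tabulate g) ≡ D.∑ (λ i → f (g i))
concatMap-tabulate {zero}  f g = sym (D.∑-zero _)
concatMap-tabulate {suc n} f g =
  trans (cong (f (g zero) ++_) (concatMap-tabulate f (λ i → g (suc i)))) (sym (D.∑-suc _))

map-rmul≈⊛ : ∀ x L → List.map (rmul x) L ≈ᵣ [ x ] ⊛ L
map-rmul≈⊛ x L = evaluations-≡ λ w → cong (evalAt w) (sym (List.++-identityʳ (List.map (rmul x) L)))

detR≈det : (M : Fin n → Fin n → Root) → detR M ≈ᵣ D.det (formal M)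
detR≈det {zero}  M = R.refl
detR≈det {suc n} M = R.trans (R.reflexive (concatMap-tabulate _ (λ j → j))) (D.∑-cong term≈)
  where
  term≈ : ∀ j → List.map (rmul (rmul (alt (toℕ j) , 1) (M zero j))) (detR (λ a b → M (suc a) (punchIn j b)))
               ≈ᵣ D.laplaceTerm (formal M) j
  term≈ j = R.trans (map-rmul≈⊛ (rmul (alt (toℕ j) , 1) (M zero j)) _)
    (R.*-cong (R.reflexive (cong (_⊛ [ M zero j ]) (sym (sign≡alt (toℕ j)))))
              (detR≈det λ a b → M (suc a) (punchIn j b)))

isqrtWeight : ℕ → ℤ
isqrtWeight r = + isqrt r

evalR≡evalAt : ∀ L → evalR L ≡ evalAt isqrtWeight L
evalR≡evalAt []            = refl
evalR≡evalAt ((c , r) ∷ L) = cong (_+_ (c * isqrtWeight r)) (evalR≡evalAt L)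

det𝔖≡evalAt-det : (B : Matrix n) → det𝔖 B ≡ evalAt isqrtWeight (D.det (formal (𝔖 B)))
det𝔖≡evalAt-det B = trans (evalR≡evalAt (detR (𝔖 B))) (evalAt-≡ (detR≈det (𝔖 B)) isqrtWeight)

𝔖-cong : {B B′ : Matrix n} → (∀ i j → B i j ≡ B′ i j) → ∀ i j → 𝔖 B i j ≡ 𝔖 B′ i j
𝔖-cong B≡B′ i j with <-cmp i j
... | tri< _ _ _ = cong₂ (λ x y → sgn x , ∣ x * y ∣) (B≡B′ i j) (B≡B′ j i)
... | tri≈ _ _ _ = refl
... | tri> _ _ _ = cong₂ (λ x y → sgn y , ∣ x * y ∣) (B≡B′ i j) (B≡B′ j i)

det𝔖-cong : {B B′ : Matrix n} → (∀ i j → B i j ≡ B′ i j) → det𝔖 B ≡ det𝔖 B′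
det𝔖-cong {B = B} {B′} B≡B′ = begin
    det𝔖 B
  ≡⟨ det𝔖≡evalAt-det B ⟩
    evalAt isqrtWeight (D.det (formal (𝔖 B)))
  ≡⟨ evalAt-≡ (D.det-cong-≡ λ i j → cong [_] (𝔖-cong B≡B′ i j)) isqrtWeight ⟩
    evalAt isqrtWeight (D.det (formal (𝔖 B′)))
  ≡⟨ det𝔖≡evalAt-det B′ ⟨
    det𝔖 B′ ∎

-- 𝔖 by recursion on the leading row and column, so that it computes on constructor patterns.
𝔖′ : Matrix n → Fin n → Fin n → Root
𝔖′ B zero    zero    = + 1 , 4
𝔖′ B zero    (suc j) = sgn (B zero (suc j)) , ∣ B zero (suc j) * B (suc j) zero ∣
𝔖′ B (suc i) zero    = sgn (B zero (suc i)) , ∣ B (suc i) zero * B zero (suc i) ∣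
𝔖′ B (suc i) (suc j) = 𝔖′ (λ a b → B (suc a) (suc b)) i j

𝔖≗𝔖′ : (B : Matrix n) → ∀ i j → 𝔖 B i j ≡ 𝔖′ B i j
𝔖≗𝔖′ B zero    zero    = refl
𝔖≗𝔖′ B zero    (suc j) = refl
𝔖≗𝔖′ B (suc i) zero    = refl
𝔖≗𝔖′ B (suc i) (suc j) = trans (𝔖-suc i j) (𝔖≗𝔖′ (λ a b → B (suc a) (suc b)) i j)
  where
  𝔖-suc : ∀ i j → 𝔖 B (suc i) (suc j) ≡ 𝔖 (λ a b → B (suc a) (suc b)) i j
  𝔖-suc i j with <-cmp i j
  ... | tri< _ _ _ = refl
  ... | tri≈ _ _ _ = refl
  ... | tri> _ _ _ = refl

det𝔖≡evalAt-det𝔖′ : (B : Matrix n) → det𝔖 B ≡ evalAt isqrtWeight (D.det (formal (𝔖′ B)))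
det𝔖≡evalAt-det𝔖′ B =
  trans (det𝔖≡evalAt-det B) (evalAt-≡ (D.det-cong-≡ λ i j → cong [_] (𝔖≗𝔖′ B i j)) isqrtWeight)

formal𝔖′-symmetric : (B : Matrix n) → ∀ i j → formal (𝔖′ B) i j ≈ᵣ formal (𝔖′ B) j i
formal𝔖′-symmetric B zero    zero    = R.refl
formal𝔖′-symmetric B zero    (suc j) = radicand-comm (B zero (suc j)) (B (suc j) zero)
  where
  radicand-comm : ∀ {s} x y → [ s , ∣ x * y ∣ ] ≈ᵣ [ s , ∣ y * x ∣ ]
  radicand-comm {s} x y = R.reflexive (cong (λ r → [ s , ∣ r ∣ ]) (ℤ.*-comm x y))
formal𝔖′-symmetric B (suc i) zero    = R.sym (formal𝔖′-symmetric B zero (suc i))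
formal𝔖′-symmetric B (suc i) (suc j) = formal𝔖′-symmetric (λ a b → B (suc a) (suc b)) i j

-- Swapping two adjacent indices

SignSkew : Matrix n → Set
SignSkew B = ∀ i j → sgn (B i j) ≡ - sgn (B j i)

skewSymmetrizable⇒signSkew : {B : Matrix n} → SkewSymmetrizable B → SignSkew B
skewSymmetrizable⇒signSkew {B = B} (d , d≢0 , DB-skew) i j = begin
  sgn (B i j)               ≡⟨ sgn-scale (d i) (B i j) ⦃ d≢0 i ⦄ ⟨
  sgn (+ d i * B i j)       ≡⟨ cong sgn (DB-skew i j) ⟩
  sgn (- (+ d j * B j i))   ≡⟨ sgn-neg (+ d j * B j i) ⟩
  - sgn (+ d j * B j i)     ≡⟨ cong -_ (sgn-scale (d j) (B j i) ⦃ d≢0 j ⦄) ⟩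
  - sgn (B j i)             ∎
  where
  sgn-scale : ∀ d z ⦃ _ : NonZero d ⦄ → sgn (+ d * z) ≡ sgn z
  sgn-scale (suc d) (+ zero) = cong sgn (ℤ.*-zeroʳ (+ suc d))
  sgn-scale (suc d) +[1+ _ ] = refl
  sgn-scale (suc d) -[1+ _ ] = refl
  sgn-neg : ∀ z → sgn (- z) ≡ - sgn z
  sgn-neg (+ zero) = refl
  sgn-neg +[1+ _ ] = refl
  sgn-neg -[1+ _ ] = refl

reindex : (Fin n → Fin n) → Matrix n → Matrix n
reindex f B i j = B (f i) (f j)

reindex-signSkew : {B : Matrix n} (f : Fin n → Fin n) → SignSkew B → SignSkew (reindex f B)
reindex-signSkew f skew i j = skew (f i) (f j)

formal𝔖′-adjacentSwap : (k : Fin m) {B : Matrix (suc m)} → SignSkew B → ∀ i j →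
  formal (𝔖′ (reindex (adjacentSwap k) B)) i j ≡
  D.negateAdjacentPair k (formal (𝔖′ B)) (adjacentSwap k i) (adjacentSwap k j)
formal𝔖′-adjacentSwap zero     skew zero          zero          = refl
formal𝔖′-adjacentSwap zero {B} skew zero          (suc zero)    =
  cong (λ s → [ s , ∣ B (suc zero) zero * B zero (suc zero) ∣ ]) (skew (suc zero) zero)
formal𝔖′-adjacentSwap zero     skew zero          (suc (suc j)) = refl
formal𝔖′-adjacentSwap zero {B} skew (suc zero)    zero          =
  cong (λ s → [ s , ∣ B zero (suc zero) * B (suc zero) zero ∣ ]) (skew (suc zero) zero)
formal𝔖′-adjacentSwap zero     skew (suc zero)    (suc zero)    = refl
formal𝔖′-adjacentSwap zero     skew (suc zero)    (suc (suc j)) = refl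
formal𝔖′-adjacentSwap zero     skew (suc (suc i)) zero          = refl
formal𝔖′-adjacentSwap zero     skew (suc (suc i)) (suc zero)    = refl
formal𝔖′-adjacentSwap zero     skew (suc (suc i)) (suc (suc j)) = refl
formal𝔖′-adjacentSwap (suc k)  skew zero          zero          = refl
formal𝔖′-adjacentSwap (suc k)  skew zero          (suc j)       = refl
formal𝔖′-adjacentSwap (suc k)  skew (suc i)       zero          = refl
formal𝔖′-adjacentSwap (suc k)  skew (suc i)       (suc j)       =
  formal𝔖′-adjacentSwap k (λ a b → skew (suc a) (suc b)) i j

evalAt-× : ∀ w n L → evalAt w (n D.× L) ≡ + n * evalAt w L
evalAt-× w zero    L = refl
evalAt-× w (suc n) L = begin
  evalAt w (L ++ n D.× L)         ≡⟨ evalAt-++ w L (n D.× L) ⟩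
  evalAt w L + evalAt w (n D.× L) ≡⟨ cong (_+_ (evalAt w L)) (evalAt-× w n L) ⟩
  evalAt w L + + n * evalAt w L   ≡⟨ ℤ.suc-* (+ n) (evalAt w L) ⟨
  + suc n * evalAt w L            ∎

det𝔖-adjacentSwap : (k : Fin m) {B : Matrix (suc m)} → SignSkew B →
  det𝔖 B ≡ det𝔖 (reindex (adjacentSwap k) B) mod 4
det𝔖-adjacentSwap k {B} skew = congruent (evalAt isqrtWeight z) (begin
    det𝔖 B
  ≡⟨ det𝔖≡evalAt-det𝔖′ B ⟩
    evalAt isqrtWeight (D.det S)
  ≡⟨ evalAt-≡ formal-step isqrtWeight ⟩
    evalAt isqrtWeight (D.det S′ ++ 4 D.× z)
  ≡⟨ evalAt-++ isqrtWeight (D.det S′) (4 D.× z) ⟩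
    evalAt isqrtWeight (D.det S′) + evalAt isqrtWeight (4 D.× z)
  ≡⟨ cong₂ _+_ (sym (det𝔖≡evalAt-det𝔖′ (reindex (adjacentSwap k) B))) (evalAt-× isqrtWeight 4 z) ⟩
    det𝔖 (reindex (adjacentSwap k) B) + + 4 * evalAt isqrtWeight z ∎)
  where
  S S′ : D.Matrix _
  S  = formal (𝔖′ B)
  S′ = formal (𝔖′ (reindex (adjacentSwap k) B))
  flip = D.det-negateAdjacentPair k S (formal𝔖′-symmetric B)
  z = proj₁ flip
  formal-step : D.det S ≈ᵣ D.det S′ ++ 4 D.× z
  formal-step = R.trans (proj₂ flip) (R.+-congʳ (R.trans
    (R.sym (D.det-swapRowsAndColumns k (D.negateAdjacentPair k S)))
    (D.det-cong-≡ λ i j → sym (formal𝔖′-adjacentSwap k {B} skew i j))))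

-- Permutations as products of adjacent transpositions

composeSwaps : List (Fin m) → Fin (suc m) → Fin (suc m)
composeSwaps []       x = x
composeSwaps (k ∷ ks) x = adjacentSwap k (composeSwaps ks x)

composeSwaps-++ : (ks ls : List (Fin m)) → ∀ x → composeSwaps (ks ++ ls) x ≡ composeSwaps ks (composeSwaps ls x)
composeSwaps-++ []       ls x = refl
composeSwaps-++ (k ∷ ks) ls x = cong (adjacentSwap k) (composeSwaps-++ ks ls x)

composeSwaps-map-suc-zero : (ks : List (Fin m)) → composeSwaps (List.map suc ks) zero ≡ zero
composeSwaps-map-suc-zero []       = refl
composeSwaps-map-suc-zero (k ∷ ks) = cong (adjacentSwap (suc k)) (composeSwaps-map-suc-zero ks)

composeSwaps-map-suc-suc : (ks : List (Fin m)) → ∀ x →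
  composeSwaps (List.map suc ks) (suc x) ≡ suc (composeSwaps ks x)
composeSwaps-map-suc-suc []       x = refl
composeSwaps-map-suc-suc (k ∷ ks) x = cong (adjacentSwap (suc k)) (composeSwaps-map-suc-suc ks x)

cycleTo : Fin (suc m) → List (Fin m)
cycleTo         zero    = []
cycleTo {suc m} (suc p) = List.map suc (cycleTo p) ++ [ zero ]

cycleTo-zero : (p : Fin (suc m)) → composeSwaps (cycleTo p) zero ≡ p
cycleTo-zero         zero    = refl
cycleTo-zero {suc m} (suc p) = begin
  composeSwaps (List.map suc (cycleTo p) ++ [ zero ]) zero ≡⟨ composeSwaps-++ (List.map suc (cycleTo p)) _ _ ⟩
  composeSwaps (List.map suc (cycleTo p)) (suc zero)       ≡⟨ composeSwaps-map-suc-suc (cycleTo p) zero ⟩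
  suc (composeSwaps (cycleTo p) zero)                      ≡⟨ cong suc (cycleTo-zero p) ⟩
  suc p                                                    ∎

cycleTo-suc : (p : Fin (suc m)) → ∀ i → composeSwaps (cycleTo p) (suc i) ≡ punchIn p i
cycleTo-suc         zero    i       = refl
cycleTo-suc {suc m} (suc p) zero    =
  trans (composeSwaps-++ (List.map suc (cycleTo p)) _ _) (composeSwaps-map-suc-zero (cycleTo p))
cycleTo-suc {suc m} (suc p) (suc i) = begin
  composeSwaps (List.map suc (cycleTo p) ++ [ zero ]) (suc (suc i)) ≡⟨ composeSwaps-++ (List.map suc (cycleTo p)) _ _ ⟩
  composeSwaps (List.map suc (cycleTo p)) (suc (suc i))             ≡⟨ composeSwaps-map-suc-suc (cycleTo p) _ ⟩
  suc (composeSwaps (cycleTo p) (suc i))                            ≡⟨ cong suc (cycleTo-suc p i) ⟩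
  suc (punchIn p i)                                                 ∎

permutation-as-adjacentSwaps : (π : Permutation′ (suc m)) →
  ∃[ ks ] ∀ x → π ⟨$⟩ʳ x ≡ composeSwaps ks x
permutation-as-adjacentSwaps {zero}  π = [] , λ x → Fin1-unique (π ⟨$⟩ʳ x) x
  where
  Fin1-unique : (x y : Fin 1) → x ≡ y
  Fin1-unique zero zero = refl
permutation-as-adjacentSwaps {suc m} π = cycleTo π₀ ++ List.map suc ks , π≗ks
  where
  π₀ = π ⟨$⟩ʳ zero
  ks = proj₁ (permutation-as-adjacentSwaps (remove zero π))
  π/0≗ks = proj₂ (permutation-as-adjacentSwaps (remove zero π))
  π≗ks : ∀ x → π ⟨$⟩ʳ x ≡ composeSwaps (cycleTo π₀ ++ List.map suc ks) x
  π≗ks zero = sym (begin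
      composeSwaps (cycleTo π₀ ++ List.map suc ks) zero
    ≡⟨ composeSwaps-++ (cycleTo π₀) _ _ ⟩
      composeSwaps (cycleTo π₀) (composeSwaps (List.map suc ks) zero)
    ≡⟨ cong (composeSwaps (cycleTo π₀)) (composeSwaps-map-suc-zero ks) ⟩
      composeSwaps (cycleTo π₀) zero
    ≡⟨ cycleTo-zero π₀ ⟩
      π₀ ∎)
  π≗ks (suc i) = sym (begin
      composeSwaps (cycleTo π₀ ++ List.map suc ks) (suc i)
    ≡⟨ composeSwaps-++ (cycleTo π₀) _ _ ⟩
      composeSwaps (cycleTo π₀) (composeSwaps (List.map suc ks) (suc i))
    ≡⟨ cong (composeSwaps (cycleTo π₀)) (composeSwaps-map-suc-suc ks i) ⟩
      composeSwaps (cycleTo π₀) (suc (composeSwaps ks i))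
    ≡⟨ cycleTo-suc π₀ (composeSwaps ks i) ⟩
      punchIn π₀ (composeSwaps ks i)
    ≡⟨ cong (punchIn π₀) (π/0≗ks i) ⟨
      punchIn π₀ (remove zero π ⟨$⟩ʳ i)
    ≡⟨ punchIn-permute π zero i ⟨
      π ⟨$⟩ʳ suc i ∎)

det𝔖-composeSwaps : (ks : List (Fin m)) {B : Matrix (suc m)} → SignSkew B →
  det𝔖 B ≡ det𝔖 (reindex (composeSwaps ks) B) mod 4
det𝔖-composeSwaps []           skew = mod-refl
det𝔖-composeSwaps (k ∷ ks) {B} skew = mod-trans
  (det𝔖-adjacentSwap k skew)
  (det𝔖-composeSwaps ks (reindex-signSkew {B = B} (adjacentSwap k) skew))

indicator : Fin n → Fin n → ℤ
indicator p k = if does (k ≟ p) then + 1 else + 0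

∑-cong : {f g : Fin n → ℤ} → (∀ i → f i ≡ g i) → ∑ f ≡ ∑ g
∑-cong {zero}  f≗g = refl
∑-cong {suc n} f≗g = cong₂ _+_ (f≗g zero) (∑-cong λ i → f≗g (suc i))

∑-zeros : ∀ n → ∑ {n} (λ _ → 0ℤ) ≡ 0ℤ
∑-zeros zero    = refl
∑-zeros (suc n) = trans (ℤ.+-identityˡ _) (∑-zeros n)

∑-indicator-* : (p : Fin n) (x : Fin n → ℤ) → ∑ (λ k → indicator p k * x k) ≡ x p
∑-indicator-* {suc n} zero    x =
  trans (cong₂ _+_ (ℤ.*-identityˡ (x zero)) (∑-zeros n)) (ℤ.+-identityʳ (x zero))
∑-indicator-* {suc n} (suc p) x = trans (ℤ.+-identityˡ _) (∑-indicator-* p (λ i → x (suc i)))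

∑-*-indicator : (p : Fin n) (x : Fin n → ℤ) → ∑ (λ k → x k * indicator p k) ≡ x p
∑-*-indicator p x = trans (∑-cong λ k → ℤ.*-comm (x k) (indicator p k)) (∑-indicator-* p x)

conjugate-permMatrix : (π : Permutation′ n) (B : Matrix n) →
  ∀ i j → ((permMatrix π · B) · transpose (permMatrix π)) i j ≡ reindex (π ⟨$⟩ʳ_) B i j
conjugate-permMatrix π B i j = trans
  (∑-*-indicator (π ⟨$⟩ʳ j) λ l → (permMatrix π · B) i l)
  (∑-indicator-* (π ⟨$⟩ʳ i) λ k → B k (π ⟨$⟩ʳ j))

lemma1p4 : (n : ℕ) (B : Matrix n) → SkewSymmetrizable B →
           (π : Permutation′ n) →
           δ ((permMatrix π · B) · transpose (permMatrix π)) ≡ δ B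
lemma1p4 zero    B skew π = refl
lemma1p4 (suc m) B skew π = begin
    δ ((permMatrix π · B) · transpose (permMatrix π))
  ≡⟨ cong (_%ℕ 4) (det𝔖-cong conjugate≗swaps) ⟩
    δ (reindex (composeSwaps ks) B)
  ≡⟨ mod⇒%ℕ≡ (det𝔖-composeSwaps ks (skewSymmetrizable⇒signSkew skew)) ⟨
    δ B ∎
  where
  ks = proj₁ (permutation-as-adjacentSwaps π)
  π≗ks = proj₂ (permutation-as-adjacentSwaps π)
  conjugate≗swaps : ∀ i j →
    ((permMatrix π · B) · transpose (permMatrix π)) i j ≡ reindex (composeSwaps ks) B i j
  conjugate≗swaps i j = trans (conjugate-permMatrix π B i j) (cong₂ B (π≗ks i) (π≗ks j))
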